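{- For every $n\geq1$, the number $T_n$ of equivalence classes of $\mathsf{and/or}$ trees of size $n$ in which at most $k_n$ distinct variables occur satisfies \[T_n = C_n\sum_{p=1}^{k_n}{n\brace p}\,2^{2n-1-p},\] where $C_n$ is the number of unlabelled binary plane trees with $n$ leaves (the $(n-1)$th Catalan number) and ${n\brace p}$ is the Stirling number of the second kind.
   Context: Variables are $x_1,x_2,\dots$; a literal is $x_i$ or $\bar x_i$. An $\mathsf{and/or}$ tree is a finite binary plane tree with internal nodes labelled $\land$ or $\lor$ and leaves labelled by literals; its size is its number of leaves. Two $\mathsf{and/or}$ trees $A,B$ are equivalent if (1) they have the same underlying plane tree with the same connective labels on internal nodes, (2) two leaves are labelled by the same variable (negated or not) in $A$ iff they are in $B$, and (3) two leaves are labelled by the same literal in $A$ iff they are in $B$. $(k_n)_{n\ge1}$ is a given sequence of positive integers. -}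

module Defs where

open import Data.Nat using (ℕ; zero; suc; _+_; _*_; _∸_; _^_; _≤_; _/_)
open import Data.Nat.Properties using (_≟_)
open import Data.Nat.Combinatorics using (_C_)
open import Data.List using (List; []; _∷_; _++_; length; map; deduplicate; applyUpTo)
open import Data.Nat.ListAction using (sum)
open import Data.List.Relation.Unary.All using (All)
open import Data.List.Relation.Unary.Any using (Any)
open import Data.List.Relation.Unary.AllPairs using (AllPairs)
open import Data.Maybe using (Maybe; just; nothing)
open import Data.Product using (Σ; ∃; _×_)
open import Function.Bundles using (_⇔_)
open import Relation.Nullary using (¬_)
open import Relation.Binary.PropositionalEquality using (_≡_)

data Lit : Set where
  pos : ℕ → Lit
  neg : ℕ → Lit

var : Lit → ℕ
var (pos i) = i
var (neg i) = i

data Conn : Set where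
  ∧′ : Conn
  ∨′ : Conn

data Tree : Set where
  leaf : Lit → Tree
  node : Conn → Tree → Tree → Tree

data Shape : Set where
  lf : Shape
  nd : Conn → Shape → Shape → Shape

shape : Tree → Shape
shape (leaf _) = lf
shape (node c l r) = nd c (shape l) (shape r)

leaves : Tree → List Lit
leaves (leaf x) = x ∷ []
leaves (node _ l r) = leaves l ++ leaves r

size : Tree → ℕ
size t = length (leaves t)

numVars : Tree → ℕ
numVars t = length (deduplicate _≟_ (map var (leaves t)))

_at_ : {A : Set} → List A → ℕ → Maybe A
[] at _ = nothing
(x ∷ xs) at zero = just x
(x ∷ xs) at suc i = xs at i

SameVar : Tree → ℕ → ℕ → Set
SameVar t i j = Σ Lit λ a → Σ Lit λ b →
  (leaves t at i ≡ just a) × (leaves t at j ≡ just b) × (var a ≡ var b)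

SameLit : Tree → ℕ → ℕ → Set
SameLit t i j = Σ Lit λ a → (leaves t at i ≡ just a) × (leaves t at j ≡ just a)

_≈T_ : Tree → Tree → Set
A ≈T B = (shape A ≡ shape B)
       × (∀ i j → SameVar A i j ⇔ SameVar B i j)
       × (∀ i j → SameLit A i j ⇔ SameLit B i j)

-- "the predicate P has exactly N equivalence classes w.r.t. _~_":
-- there is a list of N pairwise inequivalent elements satisfying P
-- such that every element satisfying P is equivalent to one of them.
NumClasses : (P : Tree → Set) (_~_ : Tree → Tree → Set) → ℕ → Set
NumClasses P _~_ N = Σ (List Tree) λ xs →
  (length xs ≡ N) × All P xs × AllPairs (λ a b → ¬ (a ~ b)) xs
  × (∀ t → P t → Any (t ~_) xs)

S : ℕ → ℕ → ℕ
S zero zero = 1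
S zero (suc p) = 0
S (suc n) zero = 0
S (suc n) (suc p) = suc p * S n (suc p) + S n p

-- C_n : number of binary plane trees with n leaves = (n-1)th Catalan number
-- Catalan m = (2m choose m)/(m+1)
catalan : ℕ → ℕ
catalan m = ((2 * m) C m) / suc m

C : ℕ → ℕ
C zero = 0
C (suc m) = catalan m

sum1to : ℕ → (ℕ → ℕ) → ℕ
sum1to k f = sum (applyUpTo (λ i → f (suc i)) k)

-- An and/or tree is its shape (the plane tree with its connective labels) together with the word
-- of its leaf literals, and equivalence constrains the word only through which positions carry the
-- same variable and which the same literal. Renaming the variables in order of first occurrence,
-- each first occurrence positive, sends every word to the unique canonical word of its class. A
-- canonical word of length n on p variables is a partition of the n positions into p blocks with a
-- sign at each of the n − p positions that are not first in their block: S(n,p) · 2^(n−p) words.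
-- Counting forests of shapes by the ballot recurrence and the reflection principle gives 2^(n−1) C_n
-- shapes with n leaves, and 2^(n−1) · 2^(n−p) = 2^(2n−1−p).

module Submission where

open import Defs
open import Data.Nat using (ℕ; zero; suc; _+_; _*_; _∸_; _^_; _≤_; _<_; z≤n; s≤s; _/_)
open import Data.Nat.Properties
  using (_≟_; _≤?_; _<?_; ≤-trans; ≤-antisym; ≤-pred; ≮⇒≥; ≰⇒>; ≤∧≢⇒<; <-irrefl; n<1+n; m<n⇒m<1+n;
         suc-injective; 1+n≢n; +-assoc; +-comm; +-suc; +-identityʳ; +-cancelʳ-≡; *-assoc; *-comm;
         *-identityʳ; *-zeroʳ; *-distribˡ-+; ^-distribˡ-+-*; m≤m+n; m+n∸m≡n; +-∸-assoc; m≤n⇒m⊓n≡m)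
open import Data.Nat.DivMod using (m*n/n≡m)
open import Data.Nat.Combinatorics using (nCk≡nC[n∸k]; nC1≡n; nCk+nC[k+1]≡[n+1]C[k+1]) renaming (_C_ to _choose_)
open import Data.Nat.ListAction using (sum)
open import Data.Nat.Tactic.RingSolver using (solve-∀)
open import Data.List
  using (List; []; _∷_; [_]; _++_; _∷ʳ_; length; map; filter; deduplicate; take; drop; concat;
         upTo; applyUpTo; cartesianProductWith; cartesianProduct)
open import Data.List.Properties
  using (length-++; length-map; length-upTo; length-take; length-drop; take++drop≡id; ++-assoc;
         ++-identityʳ; ∷ʳ-injective; ∷ʳ-injectiveˡ; map-++; filter-++; filter-accept; filter-reject)
open import Data.List.Relation.Unary.All as All using (All; []; _∷_)
import Data.List.Relation.Unary.All.Properties as All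
open import Data.List.Relation.Unary.Any as Any using (here; there)
open import Data.List.Relation.Unary.AllPairs using (AllPairs; []; _∷_)
import Data.List.Relation.Unary.AllPairs.Properties as AllPairs
open import Data.List.Relation.Unary.Unique.Propositional using (Unique)
import Data.List.Relation.Unary.Unique.Propositional.Properties as Unique
open import Data.List.Membership.Propositional using (_∈_; _∉_)
open import Data.List.Membership.Propositional.Properties
  using (∈-map⁺; ∈-map⁻; ∈-++⁺ˡ; ∈-++⁺ʳ; ∈-++⁻; ∈-upTo⁺; ∈-upTo⁻; ∈-applyUpTo⁺; ∈-applyUpTo⁻; ∈-concat⁺′;
         ∈-concat⁻′; ∈-cartesianProductWith⁺; ∈-cartesianProductWith⁻; ∈-cartesianProduct⁺; ∈-cartesianProduct⁻)
open import Data.List.Membership.DecPropositional _≟_ using (_∈?_)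
open import Data.Vec as Vec using (Vec; []; _∷_)
import Data.Vec.Properties as Vec
open import Data.Maybe using (Maybe; just; nothing)
open import Data.Product using (Σ; ∃; ∃₂; _×_; _,_; proj₁; proj₂; uncurry)
open import Data.Sum using (_⊎_; inj₁; inj₂)
open import Data.Empty using (⊥-elim)
open import Function using (_∘_)
open import Function.Bundles using (_⇔_; mk⇔; Equivalence)
open import Function.Properties.Equivalence using () renaming (sym to ⇔-sym)
open import Relation.Nullary using (¬_; Dec; yes; no; ¬?)
open import Relation.Binary.Definitions using (DecidableEquality)
open import Relation.Binary.PropositionalEquality
  using (_≡_; _≢_; refl; sym; trans; cong; cong₂; subst; subst₂; module ≡-Reasoning)
open ≡-Reasoning

private
  variable
    A : Set
    a b x a' b' x' l : Lit
    i j n q : ℕ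
    w w' u u' v : List Lit

length-∷ʳ : ∀ (w : List A) {x} → length (w ∷ʳ x) ≡ suc (length w)
length-∷ʳ w = trans (length-++ w) (+-comm (length w) 1)

length-cartesianProductWith : ∀ {B C D : Set} (f : B → C → D) xs ys →
  length (cartesianProductWith f xs ys) ≡ length xs * length ys
length-cartesianProductWith f [] ys = refl
length-cartesianProductWith f (x ∷ xs) ys = begin
  length (map (f x) ys ++ cartesianProductWith f xs ys)
    ≡⟨ length-++ (map (f x) ys) ⟩
  length (map (f x) ys) + length (cartesianProductWith f xs ys)
    ≡⟨ cong₂ _+_ (length-map (f x) ys) (length-cartesianProductWith f xs ys) ⟩
  length ys + length xs * length ys
    ∎

length-concat-applyUpTo : ∀ {B : Set} (f : ℕ → List B) k →
  length (concat (applyUpTo f k)) ≡ sum (applyUpTo (length ∘ f) k)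
length-concat-applyUpTo f zero = refl
length-concat-applyUpTo f (suc k) = trans (length-++ (f 0)) (cong (length (f 0) +_) (length-concat-applyUpTo (f ∘ suc) k))

Unique⇒AllPairs-¬ : ∀ {P : A → Set} {R : A → A → Set} {xs} → (∀ {x y} → P x → P y → R x y → x ≡ y) →
  All P xs → Unique xs → AllPairs (λ x y → ¬ R x y) xs
Unique⇒AllPairs-¬ R⇒≡ [] [] = []
Unique⇒AllPairs-¬ R⇒≡ (px ∷ pxs) (x∉xs ∷ unique) =
  All.zipWith (λ (py , x≢y) rxy → x≢y (R⇒≡ px py rxy)) (pxs , x∉xs) ∷ Unique⇒AllPairs-¬ R⇒≡ pxs unique

at-just⇒< : ∀ (w : List A) {a} → w at i ≡ just a → i < length w
at-just⇒< {i = zero} (x ∷ w) _ = s≤s z≤n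
at-just⇒< {i = suc i} (x ∷ w) e = s≤s (at-just⇒< w e)

<⇒at-just : ∀ (w : List A) → i < length w → ∃ λ a → w at i ≡ just a
<⇒at-just {i = zero} (x ∷ w) _ = x , refl
<⇒at-just {i = suc i} (x ∷ w) (s≤s i<n) = <⇒at-just w i<n

at⇒∈ : ∀ (w : List A) {a} → w at i ≡ just a → a ∈ w
at⇒∈ {i = zero} (x ∷ w) refl = here refl
at⇒∈ {i = suc i} (x ∷ w) e = there (at⇒∈ w e)

∈⇒at : ∀ {w : List A} {a} → a ∈ w → ∃ λ i → w at i ≡ just a
∈⇒at (here refl) = zero , refl
∈⇒at (there a∈w) with i , e ← ∈⇒at a∈w = suc i , e

All-at : ∀ {P : A → Set} {w : List A} {a} → All P w → w at i ≡ just a → P a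
All-at {i = zero} (pa ∷ _) refl = pa
All-at {i = suc i} (_ ∷ pw) e = All-at pw e

at-∷ʳ⁺ : ∀ (w : List A) {x a} → w at i ≡ just a → (w ∷ʳ x) at i ≡ just a
at-∷ʳ⁺ {i = zero} (y ∷ w) e = e
at-∷ʳ⁺ {i = suc i} (y ∷ w) e = at-∷ʳ⁺ w e

at-∷ʳ-length : ∀ (w : List A) {x} → (w ∷ʳ x) at length w ≡ just x
at-∷ʳ-length [] = refl
at-∷ʳ-length (y ∷ w) = at-∷ʳ-length w

at-∷ʳ⁻ : ∀ (w : List A) {x a} → (w ∷ʳ x) at i ≡ just a → w at i ≡ just a ⊎ (i ≡ length w × x ≡ a)
at-∷ʳ⁻ {i = zero} [] refl = inj₂ (refl , refl)
at-∷ʳ⁻ {i = zero} (y ∷ w) e = inj₁ e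
at-∷ʳ⁻ {i = suc i} (y ∷ w) e with at-∷ʳ⁻ w e
... | inj₁ e′ = inj₁ e′
... | inj₂ (refl , x≡a) = inj₂ (refl , x≡a)

length≡-from-at : ∀ (w w' : List A) →
  (∀ {i a} → w at i ≡ just a → ∃ λ a' → w' at i ≡ just a') →
  (∀ {i a'} → w' at i ≡ just a' → ∃ λ a → w at i ≡ just a) →
  length w ≡ length w'
length≡-from-at [] [] _ _ = refl
length≡-from-at [] (y ∷ w') _ from with from {zero} refl
... | _ , ()
length≡-from-at (x ∷ w) [] to _ with to {zero} refl
... | _ , ()
length≡-from-at (x ∷ w) (y ∷ w') to from =
  cong suc (length≡-from-at w w' (λ {i} → to {suc i}) (λ {i} → from {suc i}))

complement : Lit → Lit
complement (pos i) = neg i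
complement (neg i) = pos i

var-complement : ∀ a → var (complement a) ≡ var a
var-complement (pos i) = refl
var-complement (neg i) = refl

complement-≢ : ∀ a → complement a ≢ a
complement-≢ (pos i) ()
complement-≢ (neg i) ()

_≟ₗ_ : DecidableEquality Lit
pos i ≟ₗ pos j with i ≟ j
... | yes refl = yes refl
... | no i≢j = no λ { refl → i≢j refl }
neg i ≟ₗ neg j with i ≟ j
... | yes refl = yes refl
... | no i≢j = no λ { refl → i≢j refl }
pos i ≟ₗ neg j = no λ ()
neg i ≟ₗ pos j = no λ ()

var≡∧≢⇒complement : var a ≡ var b → a ≢ b → a ≡ complement b
var≡∧≢⇒complement {pos i} {pos .i} refl a≢b = ⊥-elim (a≢b refl)
var≡∧≢⇒complement {pos i} {neg .i} refl a≢b = refl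
var≡∧≢⇒complement {neg i} {pos .i} refl a≢b = refl
var≡∧≢⇒complement {neg i} {neg .i} refl a≢b = ⊥-elim (a≢b refl)

≡complement⇔ : (a ≡ complement b) ⇔ (var a ≡ var b × a ≢ b)
≡complement⇔ {a} {b} = mk⇔
  (λ { refl → var-complement b , complement-≢ b })
  (λ (va≡vb , a≢b) → var≡∧≢⇒complement va≡vb a≢b)

≡-by-sibling : var a ≡ var x → var a ≡ var x' → (a ≡ x ⇔ a ≡ x') → x ≡ x'
≡-by-sibling {a} {x} {x'} va≡vx va≡vx' a≡x⇔a≡x' with a ≟ₗ x
... | yes refl = Equivalence.to a≡x⇔a≡x' refl
... | no a≢x = trans (var≡∧≢⇒complement (sym va≡vx) (λ x≡a → a≢x (sym x≡a)))
                     (sym (var≡∧≢⇒complement (sym va≡vx') (λ { refl → a≢x (Equivalence.from a≡x⇔a≡x' refl) })))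

countVars : List Lit → ℕ
countVars w = length (deduplicate _≟_ (map var w))

private
  dedup : List ℕ → List ℕ
  dedup = deduplicate _≟_

  dedup-∷ʳ-∉ : ∀ ns {n} → n ∉ ns → dedup (ns ∷ʳ n) ≡ dedup ns ∷ʳ n
  dedup-∷ʳ-∉ [] _ = refl
  dedup-∷ʳ-∉ (m ∷ ns) {n} n∉ = cong (m ∷_) (begin
      filter m≢? (dedup (ns ∷ʳ n))
        ≡⟨ cong (filter m≢?) (dedup-∷ʳ-∉ ns (n∉ ∘ there)) ⟩
      filter m≢? (dedup ns ∷ʳ n)
        ≡⟨ filter-++ m≢? (dedup ns) [ n ] ⟩
      filter m≢? (dedup ns) ++ filter m≢? [ n ]
        ≡⟨ cong (filter m≢? (dedup ns) ++_) (filter-accept m≢? (λ m≡n → n∉ (here (sym m≡n)))) ⟩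
      filter m≢? (dedup ns) ∷ʳ n
        ∎)
    where m≢? = ¬? ∘ (m ≟_)

  dedup-∷ʳ-∈ : ∀ ns {n} → n ∈ ns → dedup (ns ∷ʳ n) ≡ dedup ns
  dedup-∷ʳ-∈ (m ∷ ns) (there n∈ns) = cong (λ d → m ∷ filter (¬? ∘ (m ≟_)) d) (dedup-∷ʳ-∈ ns n∈ns)
  dedup-∷ʳ-∈ (m ∷ ns) (here refl) with m ∈? ns
  ... | yes m∈ns = cong (λ d → m ∷ filter (¬? ∘ (m ≟_)) d) (dedup-∷ʳ-∈ ns m∈ns)
  ... | no m∉ns = cong (m ∷_) (begin
      filter m≢? (dedup (ns ∷ʳ m))
        ≡⟨ cong (filter m≢?) (dedup-∷ʳ-∉ ns m∉ns) ⟩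
      filter m≢? (dedup ns ∷ʳ m)
        ≡⟨ filter-++ m≢? (dedup ns) [ m ] ⟩
      filter m≢? (dedup ns) ++ filter m≢? [ m ]
        ≡⟨ cong (filter m≢? (dedup ns) ++_) (filter-reject m≢? (λ m≢m → m≢m refl)) ⟩
      filter m≢? (dedup ns) ++ []
        ≡⟨ ++-identityʳ _ ⟩
      filter m≢? (dedup ns)
        ∎)
    where m≢? = ¬? ∘ (m ≟_)

countVars-∷ʳ-∈ : ∀ w {x} → var x ∈ map var w → countVars (w ∷ʳ x) ≡ countVars w
countVars-∷ʳ-∈ w {x} vx∈w = cong length (begin
  dedup (map var (w ∷ʳ x))     ≡⟨ cong dedup (map-++ var w [ x ]) ⟩
  dedup (map var w ∷ʳ var x)   ≡⟨ dedup-∷ʳ-∈ (map var w) vx∈w ⟩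
  dedup (map var w)            ∎)

countVars-∷ʳ-∉ : ∀ w {x} → var x ∉ map var w → countVars (w ∷ʳ x) ≡ suc (countVars w)
countVars-∷ʳ-∉ w {x} vx∉w = begin
  length (dedup (map var (w ∷ʳ x)))     ≡⟨ cong (length ∘ dedup) (map-++ var w [ x ]) ⟩
  length (dedup (map var w ∷ʳ var x))   ≡⟨ cong length (dedup-∷ʳ-∉ (map var w) vx∉w) ⟩
  length (dedup (map var w) ∷ʳ var x)   ≡⟨ length-∷ʳ (dedup (map var w)) ⟩
  suc (countVars w)                     ∎

Consistent : Lit → Lit → Lit → Lit → Set
Consistent a b a' b' = (var a ≡ var b ⇔ var a' ≡ var b') × (a ≡ b ⇔ a' ≡ b')

Consistent-refl : Consistent a a a' a'
Consistent-refl = mk⇔ (λ _ → refl) (λ _ → refl) , mk⇔ (λ _ → refl) (λ _ → refl)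

Consistent-swap : Consistent a b a' b' → Consistent b a b' a'
Consistent-swap (vars , lits) =
  mk⇔ (sym ∘ Equivalence.to vars ∘ sym) (sym ∘ Equivalence.from vars ∘ sym) ,
  mk⇔ (sym ∘ Equivalence.to lits ∘ sym) (sym ∘ Equivalence.from lits ∘ sym)

Consistent-sym : Consistent a b a' b' → Consistent a' b' a b
Consistent-sym (vars , lits) = ⇔-sym vars , ⇔-sym lits

Consistent-apart : var a ≢ var b → var a' ≢ var b' → Consistent a b a' b'
Consistent-apart va≢vb va'≢vb' =
  mk⇔ (⊥-elim ∘ va≢vb) (⊥-elim ∘ va'≢vb') ,
  mk⇔ (λ { refl → ⊥-elim (va≢vb refl) }) (λ { refl → ⊥-elim (va'≢vb' refl) })

Consistent-complement : Consistent b a b' a' → Consistent b (complement a) b' (complement a')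
Consistent-complement {b} {a} {b'} {a'} (vars , lits) rewrite var-complement a | var-complement a' =
  vars , mk⇔ (move vars lits) (move (⇔-sym vars) (⇔-sym lits))
  where
  move : ∀ {c d c' d'} → (var c ≡ var d ⇔ var c' ≡ var d') → (c ≡ d ⇔ c' ≡ d') →
         c ≡ complement d → c' ≡ complement d'
  move vars lits c≡d̅ with vc≡vd , c≢d ← Equivalence.to ≡complement⇔ c≡d̅ =
    Equivalence.from ≡complement⇔ (Equivalence.to vars vc≡vd , c≢d ∘ Equivalence.from lits)

-- Conditions (2) and (3) of _≈T_ for words, read off the literals at each pair of positions.
record _≈W_ (w w' : List Lit) : Set where
  field
    length≡ : length w ≡ length w'
    consistent : ∀ {i j a b a' b'} → w at i ≡ just a → w at j ≡ just b →
                 w' at i ≡ just a' → w' at j ≡ just b' → Consistent a b a' b'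
open _≈W_

[]≈W[] : [] ≈W []
[]≈W[] = record { length≡ = refl ; consistent = λ () }

≈W-sym : w ≈W w' → w' ≈W w
≈W-sym w≈w' = record
  { length≡ = sym (length≡ w≈w')
  ; consistent = λ a'∈ b'∈ a∈ b∈ → Consistent-sym (consistent w≈w' a∈ b∈ a'∈ b'∈)
  }

≈W-∷ʳ⁻ : (w ∷ʳ x) ≈W (w' ∷ʳ x') → w ≈W w'
≈W-∷ʳ⁻ {w} {x} {w'} {x'} wx≈w'x' = record
  { length≡ = suc-injective (trans (sym (length-∷ʳ w)) (trans (length≡ wx≈w'x') (length-∷ʳ w')))
  ; consistent = λ a∈ b∈ a'∈ b'∈ →
      consistent wx≈w'x' (at-∷ʳ⁺ w a∈) (at-∷ʳ⁺ w b∈) (at-∷ʳ⁺ w' a'∈) (at-∷ʳ⁺ w' b'∈)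
  }

private
  at-∷ʳ⁻-pair : ∀ (w w' : List A) {x x' a a'} → length w ≡ length w' →
    (w ∷ʳ x) at i ≡ just a → (w' ∷ʳ x') at i ≡ just a' →
    (w at i ≡ just a × w' at i ≡ just a') ⊎ (x ≡ a × x' ≡ a')
  at-∷ʳ⁻-pair w w' w≡w' a∈ a'∈ with at-∷ʳ⁻ w a∈ | at-∷ʳ⁻ w' a'∈
  ... | inj₁ a∈w | inj₁ a'∈w' = inj₁ (a∈w , a'∈w')
  ... | inj₂ (_ , x≡a) | inj₂ (_ , x'≡a') = inj₂ (x≡a , x'≡a')
  ... | inj₁ a∈w | inj₂ (refl , _) = ⊥-elim (<-irrefl (sym w≡w') (at-just⇒< w a∈w))
  ... | inj₂ (refl , _) | inj₁ a'∈w' = ⊥-elim (<-irrefl w≡w' (at-just⇒< w' a'∈w'))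

≈W-∷ʳ : w ≈W w' →
  (∀ {i a a'} → w at i ≡ just a → w' at i ≡ just a' → Consistent a x a' x') →
  (w ∷ʳ x) ≈W (w' ∷ʳ x')
≈W-∷ʳ {w} {w'} {x} {x'} w≈w' last = record
  { length≡ = trans (length-∷ʳ w) (trans (cong suc (length≡ w≈w')) (sym (length-∷ʳ w')))
  ; consistent = λ a∈ b∈ a'∈ b'∈ → go (split a∈ a'∈) (split b∈ b'∈)
  }
  where
  split : ∀ {i a a'} → (w ∷ʳ x) at i ≡ just a → (w' ∷ʳ x') at i ≡ just a' →
          (w at i ≡ just a × w' at i ≡ just a') ⊎ (x ≡ a × x' ≡ a')
  split = at-∷ʳ⁻-pair w w' (length≡ w≈w')
  go : ∀ {i j a b a' b'} → (w at i ≡ just a × w' at i ≡ just a') ⊎ (x ≡ a × x' ≡ a') →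
       (w at j ≡ just b × w' at j ≡ just b') ⊎ (x ≡ b × x' ≡ b') → Consistent a b a' b'
  go (inj₁ (a∈ , a'∈)) (inj₁ (b∈ , b'∈)) = consistent w≈w' a∈ b∈ a'∈ b'∈
  go (inj₁ (a∈ , a'∈)) (inj₂ (refl , refl)) = last a∈ a'∈
  go (inj₂ (refl , refl)) (inj₁ (b∈ , b'∈)) = Consistent-swap (last b∈ b'∈)
  go (inj₂ (refl , refl)) (inj₂ (refl , refl)) = Consistent-refl

SameVarIn : List Lit → ℕ → ℕ → Set
SameVarIn w i j = Σ Lit λ a → Σ Lit λ b → (w at i ≡ just a) × (w at j ≡ just b) × (var a ≡ var b)

SameLitIn : List Lit → ℕ → ℕ → Set
SameLitIn w i j = Σ Lit λ a → (w at i ≡ just a) × (w at j ≡ just a)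

private
  just-unique : ∀ {m : Maybe A} {a b} → m ≡ just a → m ≡ just b → a ≡ b
  just-unique refl refl = refl

  SameVarIn-at : SameVarIn w i j → w at i ≡ just a → w at j ≡ just b → var a ≡ var b
  SameVarIn-at (c , d , c∈ , d∈ , vc≡vd) a∈ b∈
    with refl ← just-unique c∈ a∈ | refl ← just-unique d∈ b∈ = vc≡vd

  SameLitIn-at : SameLitIn w i j → w at i ≡ just a → w at j ≡ just b → a ≡ b
  SameLitIn-at (c , c∈ , c∈′) a∈ b∈ = trans (just-unique a∈ c∈) (just-unique c∈′ b∈)

  ≈W-at : w ≈W w' → w at i ≡ just a → ∃ λ a' → w' at i ≡ just a'
  ≈W-at {w} {w'} w≈w' a∈ = <⇒at-just w' (subst (_ <_) (length≡ w≈w') (at-just⇒< w a∈))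

  ≈W-SameVarIn : w ≈W w' → SameVarIn w i j → SameVarIn w' i j
  ≈W-SameVarIn w≈w' (a , b , a∈ , b∈ , va≡vb)
    with a' , a'∈ ← ≈W-at w≈w' a∈ | b' , b'∈ ← ≈W-at w≈w' b∈ =
    a' , b' , a'∈ , b'∈ , Equivalence.to (proj₁ (consistent w≈w' a∈ b∈ a'∈ b'∈)) va≡vb

  ≈W-SameLitIn : w ≈W w' → SameLitIn w i j → SameLitIn w' i j
  ≈W-SameLitIn w≈w' (a , a∈ , a∈′)
    with a' , a'∈ ← ≈W-at w≈w' a∈ | b' , b'∈ ← ≈W-at w≈w' a∈′ =
    a' , a'∈ , trans b'∈ (cong just (sym (Equivalence.to (proj₂ (consistent w≈w' a∈ a∈′ a'∈ b'∈)) refl)))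

≈W⇔ : w ≈W w' ⇔ ((∀ i j → SameVarIn w i j ⇔ SameVarIn w' i j) × (∀ i j → SameLitIn w i j ⇔ SameLitIn w' i j))
≈W⇔ {w} {w'} = mk⇔
  (λ w≈w' → (λ i j → mk⇔ (≈W-SameVarIn w≈w') (≈W-SameVarIn (≈W-sym w≈w')))
          , (λ i j → mk⇔ (≈W-SameLitIn w≈w') (≈W-SameLitIn (≈W-sym w≈w'))))
  (λ (vars , lits) → record
    { length≡ = length≡-from-at w w'
        (λ {i} a∈ → defined {w'} {i} {i} (Equivalence.to (vars i i) (_ , _ , a∈ , a∈ , refl)))
        (λ {i} a'∈ → defined {w} {i} {i} (Equivalence.from (vars i i) (_ , _ , a'∈ , a'∈ , refl)))
    ; consistent = λ {i} {j} a∈ b∈ a'∈ b'∈ →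
        mk⇔ (λ va≡vb → SameVarIn-at {w'} {i} {j} (Equivalence.to (vars i j) (_ , _ , a∈ , b∈ , va≡vb)) a'∈ b'∈)
            (λ va'≡vb' → SameVarIn-at {w} {i} {j} (Equivalence.from (vars i j) (_ , _ , a'∈ , b'∈ , va'≡vb')) a∈ b∈) ,
        mk⇔ (λ { refl → SameLitIn-at {w'} {i} {j} (Equivalence.to (lits i j) (_ , a∈ , b∈)) a'∈ b'∈ })
            (λ { refl → SameLitIn-at {w} {i} {j} (Equivalence.from (lits i j) (_ , a'∈ , b'∈)) a∈ b∈ })
    })
  where
  defined : ∀ {u i j} → SameVarIn u i j → ∃ λ c → u at i ≡ just c
  defined (c , _ , c∈ , _) = c , c∈

-- Canonical words

-- The representatives of the classes of words of length n on q variables: the variables are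
-- 0, …, q−1, they first occur in increasing order, and each first occurrence is positive.
data Canonical : ℕ → ℕ → List Lit → Set where
  [] : Canonical 0 0 []
  old : var x < q → Canonical n q u → Canonical (suc n) q (u ∷ʳ x)
  fresh : Canonical n q u → Canonical (suc n) (suc q) (u ∷ʳ pos q)

Canonical-length : Canonical n q u → length u ≡ n
Canonical-length [] = refl
Canonical-length (old {u = u} _ c) = trans (length-∷ʳ u) (cong suc (Canonical-length c))
Canonical-length (fresh {u = u} c) = trans (length-∷ʳ u) (cong suc (Canonical-length c))

Canonical-bound : Canonical n q u → All (λ x → var x < q) u
Canonical-bound [] = []
Canonical-bound (old vx<q c) = All.++⁺ (Canonical-bound c) (vx<q ∷ [])
Canonical-bound (fresh c) = All.++⁺ (All.map m<n⇒m<1+n (Canonical-bound c)) (n<1+n _ ∷ [])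

Canonical-cover : Canonical n q u → ∀ {m} → m < q → m ∈ map var u
Canonical-cover (old {x = x} {u = u} _ c) m<q =
  subst (_ ∈_) (sym (map-++ var u [ x ])) (∈-++⁺ˡ (Canonical-cover c m<q))
Canonical-cover (fresh {q = q} {u = u} c) {m} m<1+q = subst (m ∈_) (sym (map-++ var u [ pos q ])) (cover (m ≟ q))
  where
  cover : Dec (m ≡ q) → m ∈ map var u ++ [ q ]
  cover (yes refl) = ∈-++⁺ʳ (map var u) (here refl)
  cover (no m≢q) = ∈-++⁺ˡ (Canonical-cover c (≤∧≢⇒< (≤-pred m<1+q) m≢q))

private
  bounded⇒∉ : ∀ {m} → All (λ x → var x < m) u → m ∉ map var u
  bounded⇒∉ bound m∈ with b , b∈u , refl ← ∈-map⁻ var m∈ = <-irrefl refl (All.lookup bound b∈u)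

  Canonical-index-≤ : ∀ {n' q'} → Canonical n q u → Canonical n' q' u → q ≤ q'
  Canonical-index-≤ c c' = ≮⇒≥ (λ q'<q → bounded⇒∉ (Canonical-bound c') (Canonical-cover c q'<q))

Canonical-index-unique : ∀ {n' q'} → Canonical n q u → Canonical n' q' u → q ≡ q'
Canonical-index-unique c c' = ≤-antisym (Canonical-index-≤ c c') (Canonical-index-≤ c' c)

Canonical-positive : Canonical (suc n) q u → 1 ≤ q
Canonical-positive (old vx<q _) = ≤-trans (s≤s z≤n) vx<q
Canonical-positive (fresh _) = s≤s z≤n

Canonical-countVars : Canonical n q u → countVars u ≡ q
Canonical-countVars [] = refl
Canonical-countVars (old {u = u} vx<q c) =
  trans (countVars-∷ʳ-∈ u (Canonical-cover c vx<q)) (Canonical-countVars c)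
Canonical-countVars (fresh {u = u} c) =
  trans (countVars-∷ʳ-∉ u (bounded⇒∉ (Canonical-bound c))) (cong suc (Canonical-countVars c))

private
  Consistent-last : (v ∷ʳ x) ≈W (v ∷ʳ x') → v at j ≡ just b → Consistent b x b x'
  Consistent-last {v} vx≈vx' b∈ =
    consistent vx≈vx' (at-∷ʳ⁺ v b∈) (at-∷ʳ-length v) (at-∷ʳ⁺ v b∈) (at-∷ʳ-length v)

  occurrence : Canonical n q u → ∀ {m} → m < q → ∃₂ λ j b → u at j ≡ just b × var b ≡ m
  occurrence c m<q with b , b∈u , refl ← ∈-map⁻ var (Canonical-cover c m<q)
    with j , b∈ ← ∈⇒at b∈u = j , b , b∈ , refl

  old≉fresh : Canonical n q v → var x < q → ¬ (v ∷ʳ x) ≈W (v ∷ʳ pos q)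
  old≉fresh c vx<q vx≈vq with j , b , b∈ , vb≡vx ← occurrence c vx<q =
    <-irrefl (Equivalence.to (proj₁ (Consistent-last vx≈vq b∈)) vb≡vx) (All-at (Canonical-bound c) b∈)

Canonical-≈W-injective : ∀ {q'} → Canonical n q u → Canonical n q' u' → u ≈W u' → u ≡ u'
Canonical-≈W-injective [] [] _ = refl
Canonical-≈W-injective (old vx<q c) (old _ c') ux≈u'x'
  with refl ← Canonical-≈W-injective c c' (≈W-∷ʳ⁻ ux≈u'x')
  with j , b , b∈ , vb≡vx ← occurrence c vx<q =
  cong (_ ∷ʳ_) (≡-by-sibling vb≡vx (Equivalence.to vars vb≡vx) lits)
  where
  vars = proj₁ (Consistent-last ux≈u'x' b∈)
  lits = proj₂ (Consistent-last ux≈u'x' b∈)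
Canonical-≈W-injective (fresh c) (fresh c') ux≈u'x'
  with refl ← Canonical-≈W-injective c c' (≈W-∷ʳ⁻ ux≈u'x')
  with refl ← Canonical-index-unique c c' = refl
Canonical-≈W-injective (old vx<q c) (fresh c') ux≈u'x'
  with refl ← Canonical-≈W-injective c c' (≈W-∷ʳ⁻ ux≈u'x')
  with refl ← Canonical-index-unique c c' = ⊥-elim (old≉fresh c vx<q ux≈u'x')
Canonical-≈W-injective (fresh c) (old vx'<q' c') ux≈u'x'
  with refl ← Canonical-≈W-injective c c' (≈W-∷ʳ⁻ ux≈u'x')
  with refl ← Canonical-index-unique c c' = ⊥-elim (old≉fresh c' vx'<q' (≈W-sym ux≈u'x'))

literalsBelow : ℕ → List Lit
literalsBelow q = map pos (upTo q) ++ map neg (upTo q)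

∈-literalsBelow⁺ : var x < q → x ∈ literalsBelow q
∈-literalsBelow⁺ {pos i} i<q = ∈-++⁺ˡ (∈-map⁺ pos (∈-upTo⁺ i<q))
∈-literalsBelow⁺ {neg i} {q} i<q = ∈-++⁺ʳ (map pos (upTo q)) (∈-map⁺ neg (∈-upTo⁺ i<q))

∈-literalsBelow⁻ : x ∈ literalsBelow q → var x < q
∈-literalsBelow⁻ {q = q} x∈ with ∈-++⁻ (map pos (upTo q)) x∈
... | inj₁ x∈pos with i , i∈ , refl ← ∈-map⁻ pos x∈pos = ∈-upTo⁻ i∈
... | inj₂ x∈neg with i , i∈ , refl ← ∈-map⁻ neg x∈neg = ∈-upTo⁻ i∈

literalsBelow-unique : ∀ q → Unique (literalsBelow q)
literalsBelow-unique q = Unique.++⁺ (Unique.map⁺ pos-injective (Unique.upTo⁺ q))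
                                    (Unique.map⁺ neg-injective (Unique.upTo⁺ q)) pos≢neg
  where
  pos-injective : ∀ {i j} → pos i ≡ pos j → i ≡ j
  pos-injective refl = refl
  neg-injective : ∀ {i j} → neg i ≡ neg j → i ≡ j
  neg-injective refl = refl
  pos≢neg : ∀ {x} → ¬ (x ∈ map pos (upTo q) × x ∈ map neg (upTo q))
  pos≢neg (x∈pos , x∈neg) with _ , _ , refl ← ∈-map⁻ pos x∈pos with _ , _ , () ← ∈-map⁻ neg x∈neg

length-literalsBelow : ∀ q → length (literalsBelow q) ≡ q + q
length-literalsBelow q = begin
  length (map pos (upTo q) ++ map neg (upTo q))
    ≡⟨ length-++ (map pos (upTo q)) ⟩
  length (map pos (upTo q)) + length (map neg (upTo q))
    ≡⟨ cong₂ _+_ (length-map pos (upTo q)) (length-map neg (upTo q)) ⟩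
  length (upTo q) + length (upTo q)
    ≡⟨ cong₂ _+_ (length-upTo q) (length-upTo q) ⟩
  q + q
    ∎

canonicalWords : ℕ → ℕ → List (List Lit)
canonicalWords zero zero = [ [] ]
canonicalWords zero (suc q) = []
canonicalWords (suc n) zero = []
canonicalWords (suc n) (suc q) =
  cartesianProductWith _∷ʳ_ (canonicalWords n (suc q)) (literalsBelow (suc q)) ++ map (_∷ʳ pos q) (canonicalWords n q)

∈-canonicalWords⁺ : Canonical n q u → u ∈ canonicalWords n q
∈-canonicalWords⁺ [] = here refl
∈-canonicalWords⁺ (old {q = suc q} vx<q c) =
  ∈-++⁺ˡ (∈-cartesianProductWith⁺ _∷ʳ_ (∈-canonicalWords⁺ c) (∈-literalsBelow⁺ vx<q))
∈-canonicalWords⁺ (fresh {n = n} {q = q} c) =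
  ∈-++⁺ʳ (cartesianProductWith _∷ʳ_ (canonicalWords n (suc q)) (literalsBelow (suc q)))
         (∈-map⁺ (_∷ʳ pos q) (∈-canonicalWords⁺ c))

∈-canonicalWords⁻ : ∀ n q → u ∈ canonicalWords n q → Canonical n q u
∈-canonicalWords⁻ zero zero (here refl) = []
∈-canonicalWords⁻ (suc n) (suc q) u∈
  with ∈-++⁻ (cartesianProductWith _∷ʳ_ (canonicalWords n (suc q)) (literalsBelow (suc q))) u∈
... | inj₁ u∈old
  with _ , _ , v∈ , x∈ , refl ← ∈-cartesianProductWith⁻ _∷ʳ_ (canonicalWords n (suc q)) (literalsBelow (suc q)) u∈old =
  old (∈-literalsBelow⁻ x∈) (∈-canonicalWords⁻ n (suc q) v∈)
... | inj₂ u∈fresh with _ , v∈ , refl ← ∈-map⁻ (_∷ʳ pos q) u∈fresh = fresh (∈-canonicalWords⁻ n q v∈)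

canonicalWords-unique : ∀ n q → Unique (canonicalWords n q)
canonicalWords-unique zero zero = [] ∷ []
canonicalWords-unique zero (suc q) = []
canonicalWords-unique (suc n) zero = []
canonicalWords-unique (suc n) (suc q) = Unique.++⁺
  (Unique.cartesianProductWith⁺ _∷ʳ_ (λ {v} → ∷ʳ-injective v _)
     (canonicalWords-unique n (suc q)) (literalsBelow-unique (suc q)))
  (Unique.map⁺ (λ {v} → ∷ʳ-injectiveˡ v _) (canonicalWords-unique n q))
  old≢fresh
  where
  old≢fresh : ∀ {u} → ¬ (u ∈ cartesianProductWith _∷ʳ_ (canonicalWords n (suc q)) (literalsBelow (suc q))
                          × u ∈ map (_∷ʳ pos q) (canonicalWords n q))
  old≢fresh (u∈old , u∈fresh)
    with v , _ , v∈ , _ , refl ← ∈-cartesianProductWith⁻ _∷ʳ_ (canonicalWords n (suc q)) (literalsBelow (suc q)) u∈old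
    with v' , v'∈ , vx≡v'q ← ∈-map⁻ (_∷ʳ pos q) u∈fresh
    with refl ← ∷ʳ-injectiveˡ v v' vx≡v'q =
    1+n≢n (Canonical-index-unique (∈-canonicalWords⁻ n (suc q) v∈) (∈-canonicalWords⁻ n q v'∈))

S-vanishes : ∀ {n p} → n < p → S n p ≡ 0
S-vanishes {zero} {suc p} _ = refl
S-vanishes {suc n} {suc p} (s≤s n<p) rewrite S-vanishes (m<n⇒m<1+n n<p) | S-vanishes n<p =
  trans (+-identityʳ _) (*-zeroʳ (suc p))

-- For q ≥ n both sides vanish, so truncated subtraction is harmless.
S*2^-shift : ∀ n q → S n (suc q) * 2 ^ (n ∸ suc q) * 2 ≡ S n (suc q) * 2 ^ (n ∸ q)
S*2^-shift n q with q <? n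
... | yes q<n = begin
  S n (suc q) * 2 ^ (n ∸ suc q) * 2     ≡⟨ *-assoc (S n (suc q)) _ 2 ⟩
  S n (suc q) * (2 ^ (n ∸ suc q) * 2)   ≡⟨ cong (S n (suc q) *_) (*-comm (2 ^ (n ∸ suc q)) 2) ⟩
  S n (suc q) * 2 ^ suc (n ∸ suc q)     ≡⟨ cong (λ e → S n (suc q) * 2 ^ e) (sym (+-∸-assoc 1 q<n)) ⟩
  S n (suc q) * 2 ^ (n ∸ q)             ∎
... | no q≮n rewrite S-vanishes {n} {suc q} (s≤s (≮⇒≥ q≮n)) = refl

length-canonicalWords : ∀ n q → length (canonicalWords n q) ≡ S n q * 2 ^ (n ∸ q)
length-canonicalWords zero zero = refl
length-canonicalWords zero (suc q) = refl
length-canonicalWords (suc n) zero = refl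
length-canonicalWords (suc n) (suc q) = begin
  length (cartesianProductWith _∷ʳ_ ws lits ++ map (_∷ʳ pos q) ws′)
    ≡⟨ length-++ (cartesianProductWith _∷ʳ_ ws lits) ⟩
  length (cartesianProductWith _∷ʳ_ ws lits) + length (map (_∷ʳ pos q) ws′)
    ≡⟨ cong₂ _+_ (length-cartesianProductWith _∷ʳ_ ws lits) (length-map (_∷ʳ pos q) ws′) ⟩
  length ws * length lits + length ws′
    ≡⟨ cong₂ _+_ (cong₂ _*_ (length-canonicalWords n (suc q)) (length-literalsBelow (suc q))) (length-canonicalWords n q) ⟩
  S₊ * P₊ * (suc q + suc q) + S₀ * P₀
    ≡⟨ rearrange S₊ P₊ (suc q) (S₀ * P₀) ⟩
  S₊ * P₊ * 2 * suc q + S₀ * P₀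
    ≡⟨ cong (λ e → e * suc q + S₀ * P₀) (S*2^-shift n q) ⟩
  S₊ * P₀ * suc q + S₀ * P₀
    ≡⟨ collect S₊ P₀ (suc q) S₀ ⟩
  (suc q * S₊ + S₀) * P₀
    ∎
  where
  ws = canonicalWords n (suc q)
  ws′ = canonicalWords n q
  lits = literalsBelow (suc q)
  S₊ = S n (suc q)
  S₀ = S n q
  P₊ = 2 ^ (n ∸ suc q)
  P₀ = 2 ^ (n ∸ q)
  rearrange : ∀ a p r c → a * p * (r + r) + c ≡ a * p * 2 * r + c
  rearrange = solve-∀
  collect : ∀ a p r b → a * p * r + b * p ≡ (r * a + b) * p
  collect = solve-∀

relabel : Lit → Lit → Lit → Lit
relabel a a' l with l ≟ₗ a
... | yes _ = a'
... | no _ = complement a'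

var-relabel : ∀ a a' l → var (relabel a a' l) ≡ var a'
var-relabel a a' l with l ≟ₗ a
... | yes _ = refl
... | no _ = var-complement a'

Consistent-relabel : var l ≡ var a → Consistent b a b' a' → Consistent b l b' (relabel a a' l)
Consistent-relabel {l} {a} vl≡va consistent with l ≟ₗ a
... | yes refl = consistent
... | no l≢a with refl ← var≡∧≢⇒complement vl≡va l≢a = Consistent-complement consistent

partner : List Lit → List Lit → ℕ → Maybe (Lit × Lit)
partner (a ∷ h) (a' ∷ h') v with var a ≟ v
... | yes _ = just (a , a')
... | no _ = partner h h' v
partner _ _ _ = nothing

partner-just : ∀ h h' {v a a'} → partner h h' v ≡ just (a , a') →
  ∃ λ i → h at i ≡ just a × h' at i ≡ just a' × var a ≡ v
partner-just (b ∷ h) (b' ∷ h') {v} eq with var b ≟ v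
partner-just (b ∷ h) (b' ∷ h') refl | yes vb≡v = zero , refl , refl , vb≡v
... | no _ with i , a∈ , a'∈ , va≡v ← partner-just h h' eq = suc i , a∈ , a'∈ , va≡v

partner-nothing : ∀ h h' {v} → length h ≡ length h' → partner h h' v ≡ nothing → v ∉ map var h
partner-nothing (b ∷ h) (b' ∷ h') {v} h≡h' eq v∈ with var b ≟ v
partner-nothing (b ∷ h) (b' ∷ h') h≡h' () v∈ | yes _
... | no vb≢v with v∈
... | here v≡vb = vb≢v (sym v≡vb)
... | there v∈h = partner-nothing h h' (suc-injective h≡h') eq v∈h

-- The image of l, and the new number of variables, once the prefix h before l has been relabelled
-- to h' using c variables.
extend : List Lit → List Lit → ℕ → Lit → Lit × ℕ
extend h h' c l with partner h h' (var l)
... | nothing = pos c , suc c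
... | just (a , a') = relabel a a' l , c

canonise : List Lit → List Lit → ℕ → List Lit → List Lit × ℕ
canonise h h' c [] = h' , c
canonise h h' c (l ∷ w) = canonise (h ∷ʳ l) (h' ∷ʳ proj₁ (extend h h' c l)) (proj₂ (extend h h' c l)) w

canonical : List Lit → List Lit
canonical w = proj₁ (canonise [] [] 0 w)

record IsCanonicalForm (h h' : List Lit) (c : ℕ) : Set where
  field
    similar : h ≈W h'
    countVars≡ : countVars h ≡ c
    isCanonical : Canonical (length h) c h'

private
  module _ {h h' c} (I : IsCanonicalForm h h' c) where
    open IsCanonicalForm I

    var∈ : h at i ≡ just a → var a ∈ map var h
    var∈ a∈ = ∈-map⁺ var (at⇒∈ h a∈)

    extend-preserves : ∀ l → IsCanonicalForm (h ∷ʳ l) (h' ∷ʳ proj₁ (extend h h' c l)) (proj₂ (extend h h' c l))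
    extend-preserves l with partner h h' (var l) in eq
    ... | nothing = record
      { similar = ≈W-∷ʳ similar λ a∈ a'∈ →
          Consistent-apart (λ va≡vl → vl∉h (subst (_∈ map var h) va≡vl (var∈ a∈)))
                           (λ va'≡c → <-irrefl va'≡c (All-at (Canonical-bound isCanonical) a'∈))
      ; countVars≡ = trans (countVars-∷ʳ-∉ h vl∉h) (cong suc countVars≡)
      ; isCanonical = subst (λ n → Canonical n (suc c) (h' ∷ʳ pos c)) (sym (length-∷ʳ h)) (fresh isCanonical)
      }
      where
      vl∉h : var l ∉ map var h
      vl∉h = partner-nothing h h' (length≡ similar) eq
    ... | just (a , a') with i , a∈ , a'∈ , va≡vl ← partner-just h h' eq = record
      { similar = ≈W-∷ʳ similar λ b∈ b'∈ → Consistent-relabel (sym va≡vl) (consistent similar b∈ a∈ b'∈ a'∈)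
      ; countVars≡ = trans (countVars-∷ʳ-∈ h (subst (_∈ map var h) va≡vl (var∈ a∈))) countVars≡
      ; isCanonical = subst (λ n → Canonical n c (h' ∷ʳ relabel a a' l)) (sym (length-∷ʳ h))
          (old (subst (_< c) (sym (var-relabel a a' l)) (All-at (Canonical-bound isCanonical) a'∈)) isCanonical)
      }

  canonise-preserves : ∀ {h h' c} → IsCanonicalForm h h' c →
    ∀ w → IsCanonicalForm (h ++ w) (proj₁ (canonise h h' c w)) (proj₂ (canonise h h' c w))
  canonise-preserves {h} {h'} {c} I [] = subst (λ g → IsCanonicalForm g h' c) (sym (++-identityʳ h)) I
  canonise-preserves {h} {h'} {c} I (l ∷ w) =
    subst (λ g → IsCanonicalForm g (proj₁ rest) (proj₂ rest)) (++-assoc h [ l ] w)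
          (canonise-preserves (extend-preserves I l) w)
    where rest = canonise (h ∷ʳ l) (h' ∷ʳ proj₁ (extend h h' c l)) (proj₂ (extend h h' c l)) w

  canonical-isCanonicalForm : ∀ w → IsCanonicalForm w (canonical w) (proj₂ (canonise [] [] 0 w))
  canonical-isCanonicalForm = canonise-preserves (record { similar = []≈W[] ; countVars≡ = refl ; isCanonical = [] })

≈W-canonical : ∀ w → w ≈W canonical w
≈W-canonical w = IsCanonicalForm.similar (canonical-isCanonicalForm w)

canonical-Canonical : ∀ w → Canonical (length w) (countVars w) (canonical w)
canonical-Canonical w = subst (λ c → Canonical (length w) c (canonical w)) (sym countVars≡) isCanonical
  where open IsCanonicalForm (canonical-isCanonicalForm w)

-- Ballot numbers and the Catalan numbers

-- ballot m j counts the forests of j binary plane trees with m internal nodes in total.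
ballot : ℕ → ℕ → ℕ
ballot zero j = 1
ballot (suc m) zero = 0
ballot (suc m) (suc j) = ballot (suc m) j + ballot m (suc (suc j))

infixl 6.5 _C⁻_

_C⁻_ : ℕ → ℕ → ℕ
N C⁻ zero = 0
N C⁻ suc m = N choose m

pascal : ∀ N m → suc N choose m ≡ N C⁻ m + N choose m
pascal N zero = refl
pascal N (suc m) = sym (nCk+nC[k+1]≡[n+1]C[k+1] N m)

choose-symmetric : ∀ {N} k j → k + j ≡ N → N choose k ≡ N choose j
choose-symmetric k j refl = trans (nCk≡nC[n∸k] (m≤m+n k j)) (cong ((k + j) choose_) (m+n∸m≡n k j))

private
  m+[1+m]≡2m+1 : ∀ m → m + suc m ≡ 2 * m + 1
  m+[1+m]≡2m+1 = solve-∀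

  2[1+m]≡2m+2 : ∀ m → 2 * suc m ≡ suc (2 * m + 1)
  2[1+m]≡2m+2 = solve-∀

  [2+m]+m≡2m+2 : ∀ m → suc (suc m) + m ≡ suc (2 * m + 1)
  [2+m]+m≡2m+2 = solve-∀

-- The ballot theorem, in subtraction-free form.
ballot-binomial : ∀ m j → ballot m (suc j) + (2 * m + j) C⁻ m ≡ (2 * m + j) choose m
ballot-binomial zero j = refl
ballot-binomial (suc m) zero = begin
  ballot m 2 + (2 * suc m + 0) choose m     ≡⟨ cong (λ K → ballot m 2 + K choose m) index ⟩
  ballot m 2 + suc N choose m               ≡⟨ cong (ballot m 2 +_) (pascal N m) ⟩
  ballot m 2 + (N C⁻ m + N choose m)        ≡⟨ +-assoc (ballot m 2) _ _ ⟨
  ballot m 2 + N C⁻ m + N choose m          ≡⟨ cong (_+ N choose m) (ballot-binomial m 1) ⟩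
  N choose m + N choose m                   ≡⟨ cong (N choose m +_) (choose-symmetric m (suc m) (m+[1+m]≡2m+1 m)) ⟩
  N choose m + N choose suc m               ≡⟨ nCk+nC[k+1]≡[n+1]C[k+1] N m ⟩
  suc N choose suc m                        ≡⟨ cong (_choose suc m) index ⟨
  (2 * suc m + 0) choose suc m              ∎
  where
  N = 2 * m + 1
  index : 2 * suc m + 0 ≡ suc N
  index = trans (+-identityʳ (2 * suc m)) (2[1+m]≡2m+2 m)
ballot-binomial (suc m) (suc j) = begin
  X + Y + (2 * suc m + suc j) choose m      ≡⟨ cong (λ K → X + Y + K choose m) index ⟩
  X + Y + suc N choose m                    ≡⟨ cong (X + Y +_) (pascal N m) ⟩
  X + Y + (N C⁻ m + N choose m)             ≡⟨ regroup X Y (N C⁻ m) (N choose m) ⟩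
  (X + N choose m) + (Y + N C⁻ m)           ≡⟨ cong₂ _+_ (ballot-binomial (suc m) j) second ⟩
  N choose suc m + N choose m               ≡⟨ +-comm (N choose suc m) _ ⟩
  N choose m + N choose suc m               ≡⟨ nCk+nC[k+1]≡[n+1]C[k+1] N m ⟩
  suc N choose suc m                        ≡⟨ cong (_choose suc m) index ⟨
  (2 * suc m + suc j) choose suc m          ∎
  where
  X = ballot (suc m) (suc j)
  Y = ballot m (suc (suc (suc j)))
  N = 2 * suc m + j
  index : 2 * suc m + suc j ≡ suc N
  index = +-suc (2 * suc m) j
  second : Y + N C⁻ m ≡ N choose m
  second = subst (λ K → Y + K C⁻ m ≡ K choose m) (shift m j) (ballot-binomial m (suc (suc j)))
    where shift : ∀ m j → 2 * m + suc (suc j) ≡ 2 * suc m + j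
          shift = solve-∀
  regroup : ∀ x y d c → x + y + (d + c) ≡ (x + c) + (y + d)
  regroup = solve-∀

absorption : ∀ n k → suc k * (suc n choose suc k) ≡ suc n * (n choose k)
absorption n zero = trans (+-identityʳ (suc n choose 1)) (trans (nC1≡n (suc n)) (sym (*-identityʳ (suc n))))
absorption zero (suc k) = *-zeroʳ (suc (suc k))
absorption (suc n) (suc k) = begin
  suc (suc k) * (suc (suc n) choose suc (suc k))
    ≡⟨ cong (suc (suc k) *_) (nCk+nC[k+1]≡[n+1]C[k+1] (suc n) (suc k)) ⟨
  suc (suc k) * (suc n choose suc k + suc n choose suc (suc k))
    ≡⟨ expand k (suc n choose suc k) (suc n choose suc (suc k)) ⟩
  suc n choose suc k + suc k * (suc n choose suc k) + suc (suc k) * (suc n choose suc (suc k))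
    ≡⟨ cong₂ (λ a b → suc n choose suc k + a + b) (absorption n k) (absorption n (suc k)) ⟩
  suc n choose suc k + suc n * (n choose k) + suc n * (n choose suc k)
    ≡⟨ collect n (suc n choose suc k) (n choose k) (n choose suc k) ⟩
  suc n choose suc k + suc n * (n choose k + n choose suc k)
    ≡⟨ cong (λ c → suc n choose suc k + suc n * c) (nCk+nC[k+1]≡[n+1]C[k+1] n k) ⟩
  suc (suc n) * (suc n choose suc k)
    ∎
  where
  expand : ∀ k a b → suc (suc k) * (a + b) ≡ a + suc k * a + suc (suc k) * b
  expand = solve-∀
  collect : ∀ n a b c → a + suc n * b + suc n * c ≡ a + suc n * (b + c)
  collect = solve-∀

central-absorption : ∀ m → m * (2 * m choose m) ≡ suc m * (2 * m C⁻ m)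
central-absorption zero = refl
central-absorption (suc m) = begin
  suc m * (2 * suc m choose suc m)        ≡⟨ cong (λ K → suc m * (K choose suc m)) index ⟩
  suc m * (suc N choose suc m)            ≡⟨ absorption N m ⟩
  suc N * (N choose m)                    ≡⟨ cong (suc N *_) (choose-symmetric m (suc m) (m+[1+m]≡2m+1 m)) ⟩
  suc N * (N choose suc m)                ≡⟨ absorption N (suc m) ⟨
  suc (suc m) * (suc N choose suc (suc m)) ≡⟨ cong (suc (suc m) *_) (choose-symmetric (suc (suc m)) m ([2+m]+m≡2m+2 m)) ⟩
  suc (suc m) * (suc N choose m)          ≡⟨ cong (λ K → suc (suc m) * (K choose m)) index ⟨
  suc (suc m) * (2 * suc m choose m)      ∎
  where
  N = 2 * m + 1
  index : 2 * suc m ≡ suc N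
  index = 2[1+m]≡2m+2 m

catalan≡ballot : ∀ m → catalan m ≡ ballot m 1
catalan≡ballot m = trans (cong (_/ suc m) central≡) (m*n/n≡m (ballot m 1) (suc m))
  where
  X = 2 * m choose m
  D = 2 * m C⁻ m
  b+D≡X : ballot m 1 + D ≡ X
  b+D≡X = subst (λ K → ballot m 1 + K C⁻ m ≡ K choose m) (+-identityʳ (2 * m)) (ballot-binomial m 0)
  m*b≡D : m * ballot m 1 ≡ D
  m*b≡D = +-cancelʳ-≡ (m * D) _ _ (begin
    m * ballot m 1 + m * D   ≡⟨ *-distribˡ-+ m (ballot m 1) D ⟨
    m * (ballot m 1 + D)     ≡⟨ cong (m *_) b+D≡X ⟩
    m * X                    ≡⟨ central-absorption m ⟩
    suc m * D                ∎)
  central≡ : X ≡ ballot m 1 * suc m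
  central≡ = begin
    X                        ≡⟨ b+D≡X ⟨
    ballot m 1 + D           ≡⟨ cong (ballot m 1 +_) m*b≡D ⟨
    ballot m 1 + m * ballot m 1  ≡⟨ *-comm (suc m) (ballot m 1) ⟩
    ballot m 1 * suc m       ∎

-- Shapes

leafCount : Shape → ℕ
leafCount lf = 1
leafCount (nd _ a b) = leafCount a + leafCount b

internalNodes : Shape → ℕ
internalNodes lf = 0
internalNodes (nd _ a b) = suc (internalNodes a + internalNodes b)

forestNodes : ∀ {j} → Vec Shape j → ℕ
forestNodes [] = 0
forestNodes (s ∷ v) = internalNodes s + forestNodes v

leafCount≡1+internalNodes : ∀ s → leafCount s ≡ suc (internalNodes s)
leafCount≡1+internalNodes lf = refl
leafCount≡1+internalNodes (nd c a b)
  rewrite leafCount≡1+internalNodes a | leafCount≡1+internalNodes b = cong suc (+-suc (internalNodes a) (internalNodes b))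

leafCount-shape : ∀ t → leafCount (shape t) ≡ size t
leafCount-shape (leaf x) = refl
leafCount-shape (node c l r) = trans (cong₂ _+_ (leafCount-shape l) (leafCount-shape r)) (sym (length-++ (leaves l)))

graft : ∀ {j} → Conn → Vec Shape (suc (suc j)) → Vec Shape (suc j)
graft c (a ∷ b ∷ v) = nd c a b ∷ v

connectives : List Conn
connectives = ∧′ ∷ ∨′ ∷ []

forests : ℕ → (j : ℕ) → List (Vec Shape j)
forests zero j = [ Vec.replicate j lf ]
forests (suc m) zero = []
forests (suc m) (suc j) =
  map (lf ∷_) (forests (suc m) j) ++ cartesianProductWith graft connectives (forests m (suc (suc j)))

forests-nodes : ∀ m j → All (λ v → forestNodes v ≡ m) (forests m j)
forests-nodes zero j = leavesOnly j ∷ []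
  where
  leavesOnly : ∀ j → forestNodes (Vec.replicate j lf) ≡ 0
  leavesOnly zero = refl
  leavesOnly (suc j) = leavesOnly j
forests-nodes (suc m) zero = []
forests-nodes (suc m) (suc j) =
  All.++⁺ (All.map⁺ (forests-nodes (suc m) j)) (All.++⁺ (grafted ∧′) (All.++⁺ (grafted ∨′) []))
  where
  graft-nodes : ∀ c {v : Vec Shape (suc (suc j))} → forestNodes v ≡ m → forestNodes (graft c v) ≡ suc m
  graft-nodes c {a ∷ b ∷ v} nodes≡ = cong suc (trans (+-assoc (internalNodes a) _ _) nodes≡)
  grafted : ∀ c → All (λ v → forestNodes v ≡ suc m) (map (graft c) (forests m (suc (suc j))))
  grafted c = All.map⁺ (All.map (λ {v} → graft-nodes c {v}) (forests-nodes m (suc (suc j))))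

∈-connectives : ∀ c → c ∈ connectives
∈-connectives ∧′ = here refl
∈-connectives ∨′ = there (here refl)

∈-forests⁺ : ∀ m j (v : Vec Shape j) → forestNodes v ≡ m → v ∈ forests m j
∈-forests⁺ zero j v nodes≡0 = here (leavesOnly v nodes≡0)
  where
  leavesOnly : ∀ {j} (v : Vec Shape j) → forestNodes v ≡ 0 → v ≡ Vec.replicate j lf
  leavesOnly [] _ = refl
  leavesOnly (lf ∷ v) nodes≡0 = cong (lf ∷_) (leavesOnly v nodes≡0)
∈-forests⁺ (suc m) (suc j) (lf ∷ v) nodes≡ = ∈-++⁺ˡ (∈-map⁺ (lf ∷_) (∈-forests⁺ (suc m) j v nodes≡))
∈-forests⁺ (suc m) (suc j) (nd c a b ∷ v) nodes≡ =
  ∈-++⁺ʳ (map (lf ∷_) (forests (suc m) j))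
    (∈-cartesianProductWith⁺ graft (∈-connectives c)
      (∈-forests⁺ m (suc (suc j)) (a ∷ b ∷ v) (trans (sym (+-assoc (internalNodes a) _ _)) (suc-injective nodes≡))))

forests-unique : ∀ m j → Unique (forests m j)
forests-unique zero j = [] ∷ []
forests-unique (suc m) zero = []
forests-unique (suc m) (suc j) = Unique.++⁺
  (Unique.map⁺ Vec.∷-injectiveʳ (forests-unique (suc m) j))
  (Unique.cartesianProductWith⁺ graft graft-injective (((λ ()) ∷ []) ∷ [] ∷ []) (forests-unique m (suc (suc j))))
  leaf≢graft
  where
  graft-injective : ∀ {c c' : Conn} {v v' : Vec Shape (suc (suc j))} → graft c v ≡ graft c' v' → c ≡ c' × v ≡ v'
  graft-injective {v = a ∷ b ∷ v} {a' ∷ b' ∷ v'} refl = refl , refl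
  leaf≢graft : ∀ {v} → ¬ (v ∈ map (lf ∷_) (forests (suc m) j)
                          × v ∈ cartesianProductWith graft connectives (forests m (suc (suc j))))
  leaf≢graft (v∈lf , v∈nd)
    with _ , _ , refl ← ∈-map⁻ (lf ∷_) v∈lf
    with _ , _ ∷ _ ∷ _ , _ , _ , () ← ∈-cartesianProductWith⁻ graft connectives (forests m (suc (suc j))) v∈nd

length-forests : ∀ m j → length (forests m j) ≡ 2 ^ m * ballot m j
length-forests zero j = refl
length-forests (suc m) zero = sym (*-zeroʳ (2 ^ suc m))
length-forests (suc m) (suc j) = begin
  length (map (lf ∷_) (forests (suc m) j) ++ cartesianProductWith graft connectives (forests m (suc (suc j))))
    ≡⟨ length-++ (map (lf ∷_) (forests (suc m) j)) ⟩
  length (map (lf ∷_) (forests (suc m) j)) + length (cartesianProductWith graft connectives (forests m (suc (suc j))))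
    ≡⟨ cong₂ _+_ (length-map (lf ∷_) (forests (suc m) j))
                 (length-cartesianProductWith graft connectives (forests m (suc (suc j)))) ⟩
  length (forests (suc m) j) + 2 * length (forests m (suc (suc j)))
    ≡⟨ cong₂ (λ x y → x + 2 * y) (length-forests (suc m) j) (length-forests m (suc (suc j))) ⟩
  2 ^ suc m * ballot (suc m) j + 2 * (2 ^ m * ballot m (suc (suc j)))
    ≡⟨ collect (2 ^ m) (ballot (suc m) j) (ballot m (suc (suc j))) ⟩
  2 ^ suc m * ballot (suc m) (suc j)
    ∎
  where
  collect : ∀ p x y → 2 * p * x + 2 * (p * y) ≡ 2 * p * (x + y)
  collect = solve-∀

shapes : ℕ → List Shape
shapes zero = []
shapes (suc m) = map Vec.head (forests m 1)

∈-shapes⁺ : ∀ {s} m → leafCount s ≡ suc m → s ∈ shapes (suc m)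
∈-shapes⁺ {s} m leaves≡ = ∈-map⁺ Vec.head (∈-forests⁺ m 1 (s ∷ [])
  (trans (+-identityʳ (internalNodes s)) (suc-injective (trans (sym (leafCount≡1+internalNodes s)) leaves≡))))

∈-shapes⁻ : ∀ {s} n → s ∈ shapes n → leafCount s ≡ n
∈-shapes⁻ (suc m) s∈ with s ∷ [] , v∈ , refl ← ∈-map⁻ Vec.head s∈ =
  trans (leafCount≡1+internalNodes s)
        (cong suc (trans (sym (+-identityʳ (internalNodes s))) (All.lookup (forests-nodes m 1) v∈)))

shapes-unique : ∀ n → Unique (shapes n)
shapes-unique zero = []
shapes-unique (suc m) = Unique.map⁺ head-injective (forests-unique m 1)
  where
  head-injective : ∀ {v v' : Vec Shape 1} → Vec.head v ≡ Vec.head v' → v ≡ v'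
  head-injective {_ ∷ []} {_ ∷ []} refl = refl

length-shapes : ∀ m → length (shapes (suc m)) ≡ 2 ^ m * catalan m
length-shapes m = begin
  length (map Vec.head (forests m 1))   ≡⟨ length-map Vec.head (forests m 1) ⟩
  length (forests m 1)                  ≡⟨ length-forests m 1 ⟩
  2 ^ m * ballot m 1                    ≡⟨ cong (2 ^ m *_) (catalan≡ballot m) ⟨
  2 ^ m * catalan m                     ∎

fill : Shape → List Lit → Tree
fill lf [] = leaf (pos 0)
fill lf (x ∷ _) = leaf x
fill (nd c a b) w = node c (fill a (take (leafCount a) w)) (fill b (drop (leafCount a) w))

fill-correct : ∀ s w → length w ≡ leafCount s → shape (fill s w) ≡ s × leaves (fill s w) ≡ w
fill-correct lf (x ∷ []) refl = refl , refl
fill-correct (nd c a b) w length≡ =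
  cong₂ (nd c) (proj₁ left) (proj₁ right) ,
  trans (cong₂ _++_ (proj₂ left) (proj₂ right)) (take++drop≡id (leafCount a) w)
  where
  length-take′ : length (take (leafCount a) w) ≡ leafCount a
  length-take′ = trans (length-take (leafCount a) w)
                       (m≤n⇒m⊓n≡m (subst (leafCount a ≤_) (sym length≡) (m≤m+n (leafCount a) (leafCount b))))
  length-drop′ : length (drop (leafCount a) w) ≡ leafCount b
  length-drop′ = trans (length-drop (leafCount a) w)
                       (trans (cong (_∸ leafCount a) length≡) (m+n∸m≡n (leafCount a) (leafCount b)))
  left = fill-correct a (take (leafCount a) w) length-take′
  right = fill-correct b (drop (leafCount a) w) length-drop′

-- Counting representatives

sum1to-cong : ∀ k {f g : ℕ → ℕ} → (∀ p → f p ≡ g p) → sum1to k f ≡ sum1to k g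
sum1to-cong zero _ = refl
sum1to-cong (suc k) f≗g = cong₂ _+_ (f≗g 1) (sum1to-cong k (f≗g ∘ suc))

sum1to-*ˡ : ∀ k c (f : ℕ → ℕ) → sum1to k (λ p → c * f p) ≡ c * sum1to k f
sum1to-*ˡ zero c f = sym (*-zeroʳ c)
sum1to-*ˡ (suc k) c f = trans (cong (c * f 1 +_) (sum1to-*ˡ k c (f ∘ suc))) (sym (*-distribˡ-+ c (f 1) _))

-- For p > n both sides vanish, so truncated subtraction is harmless.
S*2^[2n-1-p] : ∀ m p → S (suc m) p * 2 ^ ((2 * suc m ∸ 1) ∸ p) ≡ 2 ^ m * (S (suc m) p * 2 ^ (suc m ∸ p))
S*2^[2n-1-p] m p with p ≤? suc m
... | no p≰n rewrite S-vanishes {suc m} {p} (≰⇒> p≰n) = sym (*-zeroʳ (2 ^ m))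
... | yes p≤n = begin
  S (suc m) p * 2 ^ ((2 * suc m ∸ 1) ∸ p)     ≡⟨ cong (λ e → S (suc m) p * 2 ^ ((e ∸ 1) ∸ p)) (2[1+m]≡1+m+[1+m] m) ⟩
  S (suc m) p * 2 ^ ((m + suc m) ∸ p)         ≡⟨ cong (λ e → S (suc m) p * 2 ^ e) (+-∸-assoc m p≤n) ⟩
  S (suc m) p * 2 ^ (m + (suc m ∸ p))         ≡⟨ cong (S (suc m) p *_) (^-distribˡ-+-* 2 m (suc m ∸ p)) ⟩
  S (suc m) p * (2 ^ m * 2 ^ (suc m ∸ p))     ≡⟨ x*[y*z]≡y*[x*z] (S (suc m) p) (2 ^ m) _ ⟩
  2 ^ m * (S (suc m) p * 2 ^ (suc m ∸ p))     ∎
  where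
  2[1+m]≡1+m+[1+m] : ∀ m → 2 * suc m ≡ suc (m + suc m)
  2[1+m]≡1+m+[1+m] = solve-∀
  x*[y*z]≡y*[x*z] : ∀ x y z → x * (y * z) ≡ y * (x * z)
  x*[y*z]≡y*[x*z] = solve-∀

canonicalWordsUpTo : ℕ → ℕ → List (List Lit)
canonicalWordsUpTo n k = concat (applyUpTo (λ i → canonicalWords n (suc i)) k)

∈-canonicalWordsUpTo⁺ : ∀ {k} → Canonical n q u → 1 ≤ q → q ≤ k → u ∈ canonicalWordsUpTo n k
∈-canonicalWordsUpTo⁺ {n} c (s≤s _) q≤k =
  ∈-concat⁺′ (∈-canonicalWords⁺ c) (∈-applyUpTo⁺ (λ i → canonicalWords n (suc i)) q≤k)

∈-canonicalWordsUpTo⁻ : ∀ {k} → u ∈ canonicalWordsUpTo n k → ∃ λ q → q ≤ k × Canonical n q u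
∈-canonicalWordsUpTo⁻ {n = n} u∈
  with ws , u∈ws , ws∈ ← ∈-concat⁻′ (applyUpTo (λ i → canonicalWords n (suc i)) _) u∈
  with i , i<k , refl ← ∈-applyUpTo⁻ (λ i → canonicalWords n (suc i)) ws∈ =
  suc i , i<k , ∈-canonicalWords⁻ n (suc i) u∈ws

canonicalWordsUpTo-unique : ∀ n k → Unique (canonicalWordsUpTo n k)
canonicalWordsUpTo-unique n k = Unique.concat⁺
  (All.applyUpTo⁺₂ _ k (λ i → canonicalWords-unique n (suc i)))
  (AllPairs.applyUpTo⁺₁ _ k λ i<j _ (u∈i , u∈j) →
    <-irrefl (suc-injective (Canonical-index-unique (∈-canonicalWords⁻ n _ u∈i) (∈-canonicalWords⁻ n _ u∈j))) i<j)

length-canonicalWordsUpTo : ∀ n k → length (canonicalWordsUpTo n k) ≡ sum1to k (λ p → S n p * 2 ^ (n ∸ p))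
length-canonicalWordsUpTo n k =
  trans (length-concat-applyUpTo (λ i → canonicalWords n (suc i)) k) (sum1to-cong k (length-canonicalWords n))

candidates : ℕ → ℕ → List (Shape × List Lit)
candidates n k = cartesianProduct (shapes n) (canonicalWordsUpTo n k)

representatives : ℕ → ℕ → List Tree
representatives n k = map (uncurry fill) (candidates n k)

Candidate : ℕ → ℕ → Shape × List Lit → Set
Candidate n k (s , w) = leafCount s ≡ n × ∃ λ q → q ≤ k × Canonical n q w

∈-candidates⁻ : ∀ {k p} → p ∈ candidates n k → Candidate n k p
∈-candidates⁻ {n} {k} p∈ with s∈ , w∈ ← ∈-cartesianProduct⁻ (shapes n) (canonicalWordsUpTo n k) p∈ =
  ∈-shapes⁻ n s∈ , ∈-canonicalWordsUpTo⁻ w∈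

private
  fill-Candidate : ∀ {k} s w → Candidate n k (s , w) → shape (fill s w) ≡ s × leaves (fill s w) ≡ w
  fill-Candidate s w (s≡ , _ , _ , c) = fill-correct s w (trans (Canonical-length c) (sym s≡))

fill-≈T-injective : ∀ {k p p'} → Candidate n k p → Candidate n k p' → uncurry fill p ≈T uncurry fill p' → p ≡ p'
fill-≈T-injective {p = s , w} {s' , w'} cand@(_ , _ , _ , c) cand'@(_ , _ , _ , c') (shape≡ , similar)
  with shape-s , leaves-w ← fill-Candidate s w cand
  with shape-s' , leaves-w' ← fill-Candidate s' w' cand' =
  cong₂ _,_ (trans (sym shape-s) (trans shape≡ shape-s'))
            (Canonical-≈W-injective c c' (subst₂ _≈W_ leaves-w leaves-w' (Equivalence.from ≈W⇔ similar)))

representatives-sound : ∀ {k r} → r ∈ representatives n k → size r ≡ n × numVars r ≤ k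
representatives-sound {k = k} r∈
  with (s , w) , p∈ , refl ← ∈-map⁻ (uncurry fill) r∈
  with cand@(_ , _ , q≤k , c) ← ∈-candidates⁻ p∈
  with _ , leaves≡ ← fill-Candidate s w cand =
  trans (cong length leaves≡) (Canonical-length c) ,
  subst (_≤ k) (sym (trans (cong countVars leaves≡) (Canonical-countVars c))) q≤k

canonicalTree : Tree → Tree
canonicalTree t = fill (shape t) (canonical (leaves t))

≈T-canonicalTree : ∀ t → t ≈T canonicalTree t
≈T-canonicalTree t =
  sym (proj₁ filled) , Equivalence.to ≈W⇔ (subst (leaves t ≈W_) (sym (proj₂ filled)) (≈W-canonical (leaves t)))
  where
  filled = fill-correct (shape t) (canonical (leaves t))
                        (trans (Canonical-length (canonical-Canonical (leaves t))) (sym (leafCount-shape t)))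

candidates-unique : ∀ n k → Unique (candidates n k)
candidates-unique n k = Unique.cartesianProduct⁺ (shapes-unique n) (canonicalWordsUpTo-unique n k)

canonicalTree-∈ : ∀ {m k} t → size t ≡ suc m → numVars t ≤ k → canonicalTree t ∈ representatives (suc m) k
canonicalTree-∈ {m} t size≡ numVars≤ =
  ∈-map⁺ (uncurry fill) (∈-cartesianProduct⁺ (∈-shapes⁺ m (trans (leafCount-shape t) size≡))
                                             (∈-canonicalWordsUpTo⁺ c (Canonical-positive c) numVars≤))
  where
  c = subst (λ n → Canonical n (countVars (leaves t)) (canonical (leaves t))) size≡ (canonical-Canonical (leaves t))

length-representatives : ∀ m k →
  length (representatives (suc m) k) ≡ C (suc m) * sum1to k (λ p → S (suc m) p * 2 ^ ((2 * suc m ∸ 1) ∸ p))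
length-representatives m k = begin
  length (map (uncurry fill) (candidates N k))
    ≡⟨ length-map (uncurry fill) (candidates N k) ⟩
  length (candidates N k)
    ≡⟨ length-cartesianProductWith _,_ (shapes N) (canonicalWordsUpTo N k) ⟩
  length (shapes N) * length (canonicalWordsUpTo N k)
    ≡⟨ cong₂ _*_ (length-shapes m) (length-canonicalWordsUpTo N k) ⟩
  2 ^ m * catalan m * sum1to k (λ p → S N p * 2 ^ (N ∸ p))
    ≡⟨ x*y*z≡y*[x*z] (2 ^ m) (catalan m) _ ⟩
  catalan m * (2 ^ m * sum1to k (λ p → S N p * 2 ^ (N ∸ p)))
    ≡⟨ cong (catalan m *_) (sum1to-*ˡ k (2 ^ m) (λ p → S N p * 2 ^ (N ∸ p))) ⟨
  catalan m * sum1to k (λ p → 2 ^ m * (S N p * 2 ^ (N ∸ p)))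
    ≡⟨ cong (catalan m *_) (sum1to-cong k (S*2^[2n-1-p] m)) ⟨
  C N * sum1to k (λ p → S N p * 2 ^ ((2 * N ∸ 1) ∸ p))
    ∎
  where
  N = suc m
  x*y*z≡y*[x*z] : ∀ x y z → x * y * z ≡ y * (x * z)
  x*y*z≡y*[x*z] = solve-∀

proposition1 : (k : ℕ → ℕ) → (∀ n → 1 ≤ n → 1 ≤ k n) →
    ∀ n → 1 ≤ n →
    NumClasses (λ t → (size t ≡ n) × (numVars t ≤ k n)) _≈T_
      (C n * sum1to (k n) (λ p → S n p * 2 ^ ((2 * n ∸ 1) ∸ p)))
proposition1 k _ (suc m) _ =
    representatives N K
  , length-representatives m K
  , All.tabulate representatives-sound
  , AllPairs.map⁺ (Unique⇒AllPairs-¬ (fill-≈T-injective {N} {K}) (All.tabulate (∈-candidates⁻ {N} {K}))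
                                     (candidates-unique N K))
  , λ t (size≡ , numVars≤) → Any.map (λ { refl → ≈T-canonicalTree t }) (canonicalTree-∈ t size≡ numVars≤)
  where
  N = suc m
  K = k N
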